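{- Let $(G,\gamma)$ be a connected group-labeled graph and let $T$ be a spanning tree of $G$. If there exists a shifting $\gamma'$ of $\gamma$ such that $\langle G,\gamma'\rangle\cong\mathbb{Z}_2^k$ for some $k\in\mathbb{N}$, then for every $T$-normalized shifting $\gamma''$ of $\gamma$ we have $\langle G,\gamma''\rangle\cong\mathbb{Z}_2^r$ for some $r\in\mathbb{N}$ with $r\le k$.
   Context: A group-labeled graph $(G,\gamma)$ is a finite undirected graph (loops, parallel edges allowed) with a function $\gamma$ from arcs (orientations $\vec e,\vec e^{ -1}$ of edges) to a group with $\gamma(\vec e^{ -1})=\gamma(\vec e)^{ -1}$; $\langle G,\gamma\rangle$ is the subgroup generated by all $\gamma(\vec e)$. Shifting by $\alpha$ at $v$ multiplies labels of arcs with tail $v$ on the left by $\alpha$ and labels of arcs with head $v$ on the right by $\alpha^{ -1}$; a shifting is the result of finitely many such operations. A shifting $\gamma''$ is $T$-normalized if $\gamma''(\vec e)=1$ for every edge $e$ of $T$. -}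

module Defs where

open import Level using (Level; _⊔_)
open import Data.Nat using (ℕ; zero; suc; _≤_)
open import Data.Fin using (Fin; inject₁; fromℕ; _≟_) renaming (zero to fzero; suc to fsuc)
open import Data.Fin.Subset using (Subset; _∈_; ⊤)
open import Data.Product using (Σ; ∃; _×_; _,_; proj₁; proj₂)
open import Data.Sum using (_⊎_)
open import Data.Bool using (Bool; if_then_else_; _xor_)
open import Data.List using (List; []; _∷_)
open import Data.Vec using (Vec; zipWith)
open import Function.Definitions using (Injective)
open import Relation.Nullary using (does)
open import Relation.Binary.PropositionalEquality using (_≡_)
open import Algebra.Bundles using (Group)

-- Finite undirected graphs (loops and parallel edges allowed).
-- Vertices are Fin n, edges are Fin m; each edge e carries a reference
-- orientation ends e = (tail, head).  The two arcs of e are this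
-- orientation and its reverse.

record Graph : Set where
  field
    nV   : ℕ
    nE   : ℕ
    ends : Fin nE → Fin nV × Fin nV

module _ (G : Graph) where
  open Graph G

  tail head : Fin nE → Fin nV
  tail e = proj₁ (ends e)
  head e = proj₂ (ends e)

  Joins : Fin nE → Fin nV → Fin nV → Set
  Joins e u v = ends e ≡ (u , v) ⊎ ends e ≡ (v , u)

  data Walk (S : Subset nE) : Fin nV → Fin nV → Set where
    here : ∀ {u} → Walk S u u
    step : ∀ {u w v} (e : Fin nE) → e ∈ S → Joins e u w → Walk S w v → Walk S u v

  ConnectedOn : Subset nE → Set
  ConnectedOn S = ∀ u v → Walk S u v

  Connected : Set
  Connected = ConnectedOn ⊤

  -- a cycle of length suc l in the edge set S: distinct vertices
  -- v₀ … v_l, distinct edges e₀ … e_l, with e_i joining v_i, v_{i+1}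
  -- (i < l) and e_l joining v_l, v₀.  (Length 1 = loop, length 2 =
  -- pair of parallel edges.)
  record Cycle (S : Subset nE) : Set where
    field
      len   : ℕ
      vs    : Fin (suc len) → Fin nV
      es    : Fin (suc len) → Fin nE
      vs-inj : Injective _≡_ _≡_ vs
      es-inj : Injective _≡_ _≡_ es
      es-in  : ∀ i → es i ∈ S
      es-join : ∀ (i : Fin len) → Joins (es (inject₁ i)) (vs (inject₁ i)) (vs (fsuc i))
      es-close : Joins (es (fromℕ len)) (vs (fromℕ len)) (vs fzero)

  Acyclic : Subset nE → Set
  Acyclic S = Cycle S → Data.Empty.⊥
    where import Data.Empty

  SpanningTree : Subset nE → Set
  SpanningTree T = ConnectedOn T × Acyclic T

-- Group labelings.  A labeling γ assigns to each edge e the label of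
-- its reference arc; the reverse arc gets γ e ⁻¹ (so γ(e⁻¹)=γ(e)⁻¹ holds
-- by construction).

module Labels {c ℓ : Level} (𝔾 : Group c ℓ) (G : Graph) where
  open Group 𝔾
  open Graph G

  Labeling : Set c
  Labeling = Fin nE → Carrier

  at : Fin nV → Carrier → Fin nV → Carrier
  at v α u = if does (u ≟ v) then α else ε

  -- shifting by α at v: arcs with tail v are multiplied on the left by α,
  -- arcs with head v on the right by α⁻¹ (it suffices to describe the
  -- effect on the reference arc; the reverse arc is then consistent).
  shiftAt : Fin nV → Carrier → Labeling → Labeling
  shiftAt v α γ e = (at v α (tail G e) ∙ γ e) ∙ at v (α ⁻¹) (head G e)

  applyShifts : List (Fin nV × Carrier) → Labeling → Labeling
  applyShifts []             γ = γ
  applyShifts ((v , α) ∷ os) γ = applyShifts os (shiftAt v α γ)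

  IsShifting : Labeling → Labeling → Set (c ⊔ ℓ)
  IsShifting γ γ' = Σ (List (Fin nV × Carrier)) λ os → ∀ e → γ' e ≈ applyShifts os γ e

  Normalized : Subset nE → Labeling → Set ℓ
  Normalized T γ = ∀ e → e ∈ T → γ e ≈ ε

  data InGen (γ : Labeling) : Carrier → Set (c ⊔ ℓ) where
    gen  : ∀ e → InGen γ (γ e)
    one  : InGen γ ε
    mul  : ∀ {x y} → InGen γ x → InGen γ y → InGen γ (x ∙ y)
    inv  : ∀ {x} → InGen γ x → InGen γ (x ⁻¹)
    resp : ∀ {x y} → x ≈ y → InGen γ x → InGen γ y

  -- ℤ₂^k, realised as Vec Bool k under componentwise xor
  _+₂_ : ∀ {k} → Vec Bool k → Vec Bool k → Vec Bool k
  _+₂_ = zipWith _xor_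

  record GenIsoZ2 (γ : Labeling) (k : ℕ) : Set (c ⊔ ℓ) where
    field
      f        : Vec Bool k → Carrier
      hom      : ∀ u v → f (u +₂ v) ≈ f u ∙ f v
      injective : ∀ u v → f u ≈ f v → u ≡ v
      into     : ∀ u → InGen γ (f u)
      onto     : ∀ x → InGen γ x → Σ (Vec Bool k) λ u → f u ≈ x

-- Two shiftings of γ differ by switching with a vertex potential δ: γ'' e = δ(tail e) γ' e δ(head e)⁻¹.
-- Normalisation on T gives δ(u)⁻¹ δ(w) = γ'(e) on tree edges, so δ(u)⁻¹ δ(w) ∈ ⟨G,γ'⟩ along tree walks,
-- and conjugation by δ(v₀) maps every label of γ'' into ⟨G,γ'⟩ ≅ 𝔽₂ᵏ.  A finitely generated subgroup
-- of 𝔽₂ᵏ is 𝔽₂ʳ with r ≤ k (Gaussian elimination), and conjugation is an isomorphism onto ⟨G,γ''⟩.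
module Submission where

open import Defs
open import Level using (Level)
open import Data.Nat using (ℕ; _≤_)
open import Data.Fin.Subset using (Subset)
open import Data.Product using (Σ; _×_)
open import Algebra.Bundles using (Group)

open import Data.Nat using (zero; suc; z≤n; s≤s)
open import Data.Nat.Properties using (m≤n⇒m≤1+n)
open import Data.Fin using (Fin; _≟_) renaming (zero to fzero)
open import Data.Fin.Properties using (any?)
open import Data.Fin.Subset using (_∈_)
open import Data.Bool using (Bool; true; false; _xor_)
open import Data.Bool.Properties
  using (xor-assoc; xor-comm; xor-identityˡ; xor-identityʳ; xor-same; ¬-not) renaming (_≟_ to _≟ᵇ_)
open import Data.Vec using (Vec; []; _∷_; zipWith; replicate) renaming (head to vhead; tail to vtail)
open import Data.Vec.Relation.Binary.Pointwise.Inductive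
  using (Pointwise-≡⇒≡; zipWith-assoc; zipWith-comm; zipWith-identityˡ; zipWith-identityʳ)
open import Data.Product using (_,_; proj₁; proj₂; ∃)
open import Data.Sum using (inj₁; inj₂)
open import Data.List using (List; []; _∷_)
open import Data.Empty using (⊥-elim)
open import Function using (_∘_)
open import Relation.Nullary using (Dec; yes; no; does)
open import Relation.Binary.PropositionalEquality
  using (_≡_; refl; sym; trans; cong; cong₂; subst; module ≡-Reasoning)
import Algebra.Solver.Monoid as MonoidSolver

infixl 6 _⊕_
infixr 7 _·_

_⊕_ : ∀ {k} → Vec Bool k → Vec Bool k → Vec Bool k
_⊕_ = zipWith _xor_

𝟘 : ∀ {k} → Vec Bool k
𝟘 {k} = replicate k false

_·_ : ∀ {k} → Bool → Vec Bool k → Vec Bool k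
true  · v = v
false · v = 𝟘

⊕-assoc : ∀ {k} (u v w : Vec Bool k) → (u ⊕ v) ⊕ w ≡ u ⊕ (v ⊕ w)
⊕-assoc u v w = Pointwise-≡⇒≡ (zipWith-assoc xor-assoc u v w)

⊕-comm : ∀ {k} (u v : Vec Bool k) → u ⊕ v ≡ v ⊕ u
⊕-comm u v = Pointwise-≡⇒≡ (zipWith-comm xor-comm u v)

⊕-identityˡ : ∀ {k} (u : Vec Bool k) → 𝟘 ⊕ u ≡ u
⊕-identityˡ u = Pointwise-≡⇒≡ (zipWith-identityˡ xor-identityˡ u)

⊕-identityʳ : ∀ {k} (u : Vec Bool k) → u ⊕ 𝟘 ≡ u
⊕-identityʳ u = Pointwise-≡⇒≡ (zipWith-identityʳ xor-identityʳ u)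

⊕-interchange : ∀ {k} (a b c d : Vec Bool k) → (a ⊕ b) ⊕ (c ⊕ d) ≡ (a ⊕ c) ⊕ (b ⊕ d)
⊕-interchange a b c d = begin
  (a ⊕ b) ⊕ (c ⊕ d)  ≡⟨ ⊕-assoc a b (c ⊕ d) ⟩
  a ⊕ (b ⊕ (c ⊕ d))  ≡⟨ cong (a ⊕_) (sym (⊕-assoc b c d)) ⟩
  a ⊕ ((b ⊕ c) ⊕ d)  ≡⟨ cong (λ x → a ⊕ (x ⊕ d)) (⊕-comm b c) ⟩
  a ⊕ ((c ⊕ b) ⊕ d)  ≡⟨ cong (a ⊕_) (⊕-assoc c b d) ⟩
  a ⊕ (c ⊕ (b ⊕ d))  ≡⟨ sym (⊕-assoc a c (b ⊕ d)) ⟩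
  (a ⊕ c) ⊕ (b ⊕ d)  ∎
  where open ≡-Reasoning

⊕-self : ∀ {k} (u : Vec Bool k) → u ⊕ u ≡ 𝟘
⊕-self []      = refl
⊕-self (x ∷ u) = cong₂ _∷_ (xor-same x) (⊕-self u)

⊕-selfˡ : ∀ {k} (u v : Vec Bool k) → u ⊕ (u ⊕ v) ≡ v
⊕-selfˡ u v = trans (sym (⊕-assoc u u v)) (trans (cong (_⊕ v) (⊕-self u)) (⊕-identityˡ v))

⊕-cancelˡ : ∀ {k} (u v w : Vec Bool k) → u ⊕ v ≡ u ⊕ w → v ≡ w
⊕-cancelˡ u v w eq = trans (sym (⊕-selfˡ u v)) (trans (cong (u ⊕_) eq) (⊕-selfˡ u w))

·-distribʳ-xor : ∀ {k} x y (v : Vec Bool k) → (x xor y) · v ≡ x · v ⊕ y · v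
·-distribʳ-xor false false v = sym (⊕-identityˡ 𝟘)
·-distribʳ-xor false true  v = sym (⊕-identityˡ v)
·-distribʳ-xor true  false v = sym (⊕-identityʳ v)
·-distribʳ-xor true  true  v = sym (⊕-self v)

vhead≡⇒≡∷vtail : ∀ {n} {A : Set} {x : A} (v : Vec A (suc n)) → vhead v ≡ x → v ≡ x ∷ vtail v
vhead≡⇒≡∷vtail (y ∷ v) refl = refl

data Span {k m} (bs : Fin m → Vec Bool k) : Vec Bool k → Set where
  span-𝟘   : Span bs 𝟘
  span-gen : ∀ i → Span bs (bs i)
  span-⊕   : ∀ {u v} → Span bs u → Span bs v → Span bs (u ⊕ v)

span-lift : ∀ {k m n} {bs : Fin m → Vec Bool (suc k)} {cs : Fin n → Vec Bool k} →
            (∀ i → Span bs (false ∷ cs i)) → ∀ {v} → Span cs v → Span bs (false ∷ v)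
span-lift lift-gen span-𝟘       = span-𝟘
span-lift lift-gen (span-gen i) = lift-gen i
span-lift lift-gen (span-⊕ s t) = span-⊕ (span-lift lift-gen s) (span-lift lift-gen t)

record Basis {k m} (bs : Fin m → Vec Bool k) : Set where
  field
    dim             : ℕ
    dim≤k           : dim ≤ k
    embed           : Vec Bool dim → Vec Bool k
    embed-⊕         : ∀ u v → embed (u ⊕ v) ≡ embed u ⊕ embed v
    embed-injective : ∀ u v → embed u ≡ embed v → u ≡ v
    embed-∈span     : ∀ u → Span bs (embed u)
    gen-∈image      : ∀ i → ∃ λ u → embed u ≡ bs i

basis-without-pivot : ∀ {k m} (bs : Fin m → Vec Bool (suc k)) →
                      (∀ i → bs i ≡ false ∷ vtail (bs i)) → Basis (vtail ∘ bs) → Basis bs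
basis-without-pivot bs first-zero B = record
  { dim             = dim
  ; dim≤k           = m≤n⇒m≤1+n dim≤k
  ; embed           = (false ∷_) ∘ embed
  ; embed-⊕         = λ u v → cong (false ∷_) (embed-⊕ u v)
  ; embed-injective = λ u v eq → embed-injective u v (cong vtail eq)
  ; embed-∈span     = span-lift (λ i → subst (Span bs) (first-zero i) (span-gen i)) ∘ embed-∈span
  ; gen-∈image      = λ i → let u , eq = gen-∈image i in u , trans (cong (false ∷_) eq) (sym (first-zero i))
  }
  where open Basis B

module _ {k m} (bs : Fin m → Vec Bool (suc k)) (j : Fin m) (p : Vec Bool k) (pivot : bs j ≡ true ∷ p) where

  clear-first : Vec Bool (suc k) → Vec Bool k
  clear-first (x ∷ v) = x · p ⊕ v

  span-clear-first : ∀ {v} → Span bs v → Span bs (false ∷ clear-first v)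
  span-clear-first {true  ∷ v} s = span-⊕ (subst (Span bs) pivot (span-gen j)) s
  span-clear-first {false ∷ v} s = span-⊕ span-𝟘 s

  basis-with-pivot : Basis (clear-first ∘ bs) → Basis bs
  basis-with-pivot B = record
    { dim             = suc dim
    ; dim≤k           = s≤s dim≤k
    ; embed           = embed′
    ; embed-⊕         = embed′-⊕
    ; embed-injective = embed′-injective
    ; embed-∈span     = embed′-∈span
    ; gen-∈image      = λ i → let u , eq = gen-∈image i in vhead (bs i) ∷ u , embed′-clear-first (bs i) u eq
    }
    where
      open Basis B

      embed′ : Vec Bool (suc dim) → Vec Bool (suc k)
      embed′ (x ∷ u) = x ∷ (x · p ⊕ embed u)

      embed′-⊕ : ∀ u v → embed′ (u ⊕ v) ≡ embed′ u ⊕ embed′ v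
      embed′-⊕ (x ∷ u) (y ∷ v) = cong ((x xor y) ∷_) (trans
        (cong₂ _⊕_ (·-distribʳ-xor x y p) (embed-⊕ u v))
        (⊕-interchange (x · p) (y · p) (embed u) (embed v)))

      embed′-injective : ∀ u v → embed′ u ≡ embed′ v → u ≡ v
      embed′-injective (x ∷ u) (y ∷ v) eq with cong vhead eq
      ... | refl = cong (x ∷_) (embed-injective u v (⊕-cancelˡ (x · p) (embed u) (embed v) (cong vtail eq)))

      lift-embed-∈span : ∀ u → Span bs (false ∷ embed u)
      lift-embed-∈span u = span-lift (span-clear-first ∘ span-gen) (embed-∈span u)

      embed′-∈span : ∀ u → Span bs (embed′ u)
      embed′-∈span (true  ∷ u) = span-⊕ (subst (Span bs) pivot (span-gen j)) (lift-embed-∈span u)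
      embed′-∈span (false ∷ u) = span-⊕ span-𝟘 (lift-embed-∈span u)

      embed′-clear-first : ∀ v u → embed u ≡ clear-first v → embed′ (vhead v ∷ u) ≡ v
      embed′-clear-first (x ∷ v) u eq = cong (x ∷_) (trans (cong (x · p ⊕_) eq) (⊕-selfˡ (x · p) v))

-- Gaussian elimination on the first coordinate
basis : ∀ k {m} (bs : Fin m → Vec Bool k) → Basis bs
basis zero bs = record
  { dim = 0 ; dim≤k = z≤n ; embed = λ u → u ; embed-⊕ = λ _ _ → refl
  ; embed-injective = λ _ _ eq → eq ; embed-∈span = λ { [] → span-𝟘 } ; gen-∈image = λ i → bs i , refl }
basis (suc k) bs with any? (λ i → vhead (bs i) ≟ᵇ true)
... | yes (j , head-true) =
  basis-with-pivot bs j (vtail (bs j)) (vhead≡⇒≡∷vtail (bs j) head-true) (basis k _)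
... | no no-pivot =
  basis-without-pivot bs (λ i → vhead≡⇒≡∷vtail (bs i) (¬-not λ h → no-pivot (i , h))) (basis k _)

Fin-inhabited? : ∀ n → Dec (Fin n)
Fin-inhabited? zero    = no λ ()
Fin-inhabited? (suc n) = yes fzero

module _ {c ℓ : Level} (𝔾 : Group c ℓ) where
  open Group 𝔾 renaming (refl to ≈-refl; sym to ≈-sym; trans to ≈-trans)
  open import Algebra.Properties.Group 𝔾
    using (ε⁻¹≈ε; ⁻¹-anti-homo-∙; ⁻¹-involutive; inverseʳ-unique; x∙y⁻¹≈ε⇒x≈y; ∙-cancelˡ)
  open MonoidSolver monoid using (solve; _⊜_) renaming (_⊕_ to _⊛_; id to ι)
  open import Relation.Binary.Reasoning.Setoid setoid

  idempotent⇒ε : ∀ x → x ∙ x ≈ x → x ≈ ε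
  idempotent⇒ε x xx≈x = ∙-cancelˡ x x ε (≈-trans xx≈x (≈-sym (identityʳ x)))

  module _ {n} {φ : Vec Bool n → Carrier} (φ-⊕ : ∀ u v → φ (u ⊕ v) ≈ φ u ∙ φ v) where

    homZ₂-𝟘 : φ 𝟘 ≈ ε
    homZ₂-𝟘 = idempotent⇒ε (φ 𝟘) (≈-trans (≈-sym (φ-⊕ 𝟘 𝟘)) (reflexive (cong φ (⊕-self 𝟘))))

    homZ₂-⁻¹ : ∀ u → φ u ⁻¹ ≈ φ u
    homZ₂-⁻¹ u = ≈-sym (inverseʳ-unique (φ u) (φ u)
      (≈-trans (≈-sym (φ-⊕ u u)) (≈-trans (reflexive (cong φ (⊕-self u))) homZ₂-𝟘)))

  conj : Carrier → Carrier → Carrier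
  conj a x = (a ⁻¹ ∙ x) ∙ a

  conj-cong : ∀ a {x y} → x ≈ y → conj a x ≈ conj a y
  conj-cong a x≈y = ∙-congʳ (∙-congˡ x≈y)

  conj-ε : ∀ a → conj a ε ≈ ε
  conj-ε a = ≈-trans (∙-congʳ (identityʳ (a ⁻¹))) (inverseˡ a)

  conj-∙ : ∀ a x y → conj a (x ∙ y) ≈ conj a x ∙ conj a y
  conj-∙ a x y = begin
    (a ⁻¹ ∙ (x ∙ y)) ∙ a
      ≈⟨ solve 4 (λ A x y a → ((A ⊛ (x ⊛ y)) ⊛ a) ⊜ (((A ⊛ x) ⊛ ι) ⊛ (y ⊛ a))) ≈-refl (a ⁻¹) x y a ⟩
    ((a ⁻¹ ∙ x) ∙ ε) ∙ (y ∙ a)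
      ≈⟨ ∙-congʳ (∙-congˡ (≈-sym (inverseʳ a))) ⟩
    ((a ⁻¹ ∙ x) ∙ (a ∙ a ⁻¹)) ∙ (y ∙ a)
      ≈⟨ solve 4 (λ A x a y → (((A ⊛ x) ⊛ (a ⊛ A)) ⊛ (y ⊛ a)) ⊜ (((A ⊛ x) ⊛ a) ⊛ ((A ⊛ y) ⊛ a)))
                 ≈-refl (a ⁻¹) x a y ⟩
    conj a x ∙ conj a y
      ∎

  conj-⁻¹ : ∀ a x → conj a (x ⁻¹) ≈ conj a x ⁻¹
  conj-⁻¹ a x = inverseʳ-unique (conj a x) (conj a (x ⁻¹))
    (≈-trans (≈-sym (conj-∙ a x (x ⁻¹))) (≈-trans (conj-cong a (inverseʳ x)) (conj-ε a)))

  conj-conj : ∀ a b x → b ∙ a ≈ ε → conj a (conj b x) ≈ x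
  conj-conj a b x ba≈ε = begin
    (a ⁻¹ ∙ ((b ⁻¹ ∙ x) ∙ b)) ∙ a
      ≈⟨ solve 5 (λ A B x b a → ((A ⊛ ((B ⊛ x) ⊛ b)) ⊛ a) ⊜ (((A ⊛ B) ⊛ x) ⊛ (b ⊛ a)))
                 ≈-refl (a ⁻¹) (b ⁻¹) x b a ⟩
    ((a ⁻¹ ∙ b ⁻¹) ∙ x) ∙ (b ∙ a)
      ≈⟨ ∙-cong (∙-congʳ (≈-sym (⁻¹-anti-homo-∙ b a))) ba≈ε ⟩
    ((b ∙ a) ⁻¹ ∙ x) ∙ ε
      ≈⟨ ∙-congʳ (∙-congʳ (≈-trans (⁻¹-cong ba≈ε) ε⁻¹≈ε)) ⟩
    (ε ∙ x) ∙ ε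
      ≈⟨ solve 1 (λ x → ((ι ⊛ x) ⊛ ι) ⊜ x) ≈-refl x ⟩
    x
      ∎

  conj-injective : ∀ a {x y} → conj a x ≈ conj a y → x ≈ y
  conj-injective a {x} {y} eq = begin
    x                      ≈⟨ conj-conj (a ⁻¹) a x (inverseʳ a) ⟨
    conj (a ⁻¹) (conj a x) ≈⟨ conj-cong (a ⁻¹) eq ⟩
    conj (a ⁻¹) (conj a y) ≈⟨ conj-conj (a ⁻¹) a y (inverseʳ a) ⟩
    y                      ∎

  module _ (G : Graph) where
    open Graph G
    open Labels 𝔾 G

    Potential : Set c
    Potential = Fin nV → Carrier

    switch : Potential → Labeling → Labeling
    switch δ γ e = (δ (tail G e) ∙ γ e) ∙ δ (head G e) ⁻¹

    switch-ε : ∀ γ e → γ e ≈ switch (λ _ → ε) γ e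
    switch-ε γ e = ≈-trans (solve 1 (λ x → x ⊜ ((ι ⊛ x) ⊛ ι)) ≈-refl (γ e)) (∙-congˡ (≈-sym ε⁻¹≈ε))

    switch-switch : ∀ δ₁ δ₂ γ e → switch δ₂ (switch δ₁ γ) e ≈ switch (λ v → δ₂ v ∙ δ₁ v) γ e
    switch-switch δ₁ δ₂ γ e = ≈-trans
      (solve 5 (λ d₂ d₁ x E₁ E₂ → ((d₂ ⊛ ((d₁ ⊛ x) ⊛ E₁)) ⊛ E₂) ⊜ (((d₂ ⊛ d₁) ⊛ x) ⊛ (E₁ ⊛ E₂))) ≈-refl
         (δ₂ (tail G e)) (δ₁ (tail G e)) (γ e) (δ₁ (head G e) ⁻¹) (δ₂ (head G e) ⁻¹))
      (∙-congˡ (≈-sym (⁻¹-anti-homo-∙ (δ₂ (head G e)) (δ₁ (head G e)))))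

    switch-congˡ : ∀ {δ δ′} γ → (∀ v → δ v ≈ δ′ v) → ∀ e → switch δ γ e ≈ switch δ′ γ e
    switch-congˡ γ δ≈δ′ e = ∙-cong (∙-congʳ (δ≈δ′ (tail G e))) (⁻¹-cong (δ≈δ′ (head G e)))

    switch-congʳ : ∀ δ γ γ′ e → γ e ≈ γ′ e → switch δ γ e ≈ switch δ γ′ e
    switch-congʳ δ γ γ′ e γe≈γ′e = ∙-congʳ (∙-congˡ γe≈γ′e)

    at-⁻¹ : ∀ v α u → at v (α ⁻¹) u ≈ at v α u ⁻¹
    at-⁻¹ v α u with does (u ≟ v)
    ... | true  = ≈-refl
    ... | false = ≈-sym ε⁻¹≈ε

    shiftAt≈switch : ∀ v α γ e → shiftAt v α γ e ≈ switch (at v α) γ e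
    shiftAt≈switch v α γ e = ∙-congˡ (at-⁻¹ v α (head G e))

    potential : List (Fin nV × Carrier) → Potential
    potential []             u = ε
    potential ((v , α) ∷ os) u = potential os u ∙ at v α u

    applyShifts≈switch : ∀ os γ e → applyShifts os γ e ≈ switch (potential os) γ e
    applyShifts≈switch []             γ e = switch-ε γ e
    applyShifts≈switch ((v , α) ∷ os) γ e = begin
      applyShifts os (shiftAt v α γ) e             ≈⟨ applyShifts≈switch os (shiftAt v α γ) e ⟩
      switch (potential os) (shiftAt v α γ) e      ≈⟨ switch-congʳ (potential os) (shiftAt v α γ) (switch (at v α) γ) e
                                                                     (shiftAt≈switch v α γ e) ⟩
      switch (potential os) (switch (at v α) γ) e  ≈⟨ switch-switch (at v α) (potential os) γ e ⟩
      switch (potential ((v , α) ∷ os)) γ e        ∎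

    shiftings-differ-by-switch : ∀ {γ γ′ γ″} → IsShifting γ γ′ → IsShifting γ γ″ →
                                 Σ Potential λ δ → ∀ e → γ″ e ≈ switch δ γ′ e
    shiftings-differ-by-switch {γ} {γ′} {γ″} (os′ , γ′≈) (os″ , γ″≈) = δ , γ″≈switch
      where
        δ : Potential
        δ v = potential os″ v ∙ potential os′ v ⁻¹

        δ∙potential′ : ∀ v → δ v ∙ potential os′ v ≈ potential os″ v
        δ∙potential′ v = ≈-trans (assoc _ _ _) (≈-trans (∙-congˡ (inverseˡ _)) (identityʳ _))

        γ″≈switch : ∀ e → γ″ e ≈ switch δ γ′ e
        γ″≈switch e = begin
          γ″ e                                      ≈⟨ γ″≈ e ⟩
          applyShifts os″ γ e                       ≈⟨ applyShifts≈switch os″ γ e ⟩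
          switch (potential os″) γ e                ≈⟨ switch-congˡ γ δ∙potential′ e ⟨
          switch (λ v → δ v ∙ potential os′ v) γ e  ≈⟨ switch-switch (potential os′) δ γ e ⟨
          switch δ (switch (potential os′) γ) e     ≈⟨ switch-congʳ δ γ′ (switch (potential os′) γ) e
                                                         (≈-trans (γ′≈ e) (applyShifts≈switch os′ γ e)) ⟨
          switch δ γ′ e                             ∎

    module _ {T : Subset nE} {γ γ′ : Labeling} (δ : Potential)
             (γ≈switch : ∀ e → γ e ≈ switch δ γ′ e) (normalized : Normalized T γ) where

      tree-edge-label : ∀ e → e ∈ T → δ (tail G e) ⁻¹ ∙ δ (head G e) ≈ γ′ e
      tree-edge-label e e∈T = begin
        δ (tail G e) ⁻¹ ∙ δ (head G e)           ≈⟨ ∙-congˡ (x∙y⁻¹≈ε⇒x≈y _ _ switch≈ε) ⟨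
        δ (tail G e) ⁻¹ ∙ (δ (tail G e) ∙ γ′ e)  ≈⟨ assoc _ _ _ ⟨
        (δ (tail G e) ⁻¹ ∙ δ (tail G e)) ∙ γ′ e  ≈⟨ ∙-congʳ (inverseˡ _) ⟩
        ε ∙ γ′ e                                 ≈⟨ identityˡ _ ⟩
        γ′ e                                     ∎
        where
          switch≈ε : switch δ γ′ e ≈ ε
          switch≈ε = ≈-trans (≈-sym (γ≈switch e)) (normalized e e∈T)

      tree-edge-∈ : ∀ {u w} e → e ∈ T → Joins G e u w → InGen γ′ (δ u ⁻¹ ∙ δ w)
      tree-edge-∈ e e∈T (inj₁ refl) = resp (≈-sym (tree-edge-label e e∈T)) (gen e)
      tree-edge-∈ e e∈T (inj₂ refl) = resp reverse (inv (resp (≈-sym (tree-edge-label e e∈T)) (gen e)))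
        where
          reverse : (δ (tail G e) ⁻¹ ∙ δ (head G e)) ⁻¹ ≈ δ (head G e) ⁻¹ ∙ δ (tail G e)
          reverse = ≈-trans (⁻¹-anti-homo-∙ _ _) (∙-congˡ (⁻¹-involutive _))

      tree-walk-∈ : ∀ {u w} → Walk G T u w → InGen γ′ (δ u ⁻¹ ∙ δ w)
      tree-walk-∈ here                  = resp (≈-sym (inverseˡ _)) one
      tree-walk-∈ (step e e∈T joins w) = resp telescope (mul (tree-edge-∈ e e∈T joins) (tree-walk-∈ w))
        where
          telescope : ∀ {x y z} → (x ⁻¹ ∙ y) ∙ (y ⁻¹ ∙ z) ≈ x ⁻¹ ∙ z
          telescope {x} {y} {z} = begin
            (x ⁻¹ ∙ y) ∙ (y ⁻¹ ∙ z)  ≈⟨ solve 4 (λ X y Y z → ((X ⊛ y) ⊛ (Y ⊛ z)) ⊜ (X ⊛ ((y ⊛ Y) ⊛ z)))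
                                               ≈-refl (x ⁻¹) y (y ⁻¹) z ⟩
            x ⁻¹ ∙ ((y ∙ y ⁻¹) ∙ z)  ≈⟨ ∙-congˡ (≈-trans (∙-congʳ (inverseʳ y)) (identityˡ z)) ⟩
            x ⁻¹ ∙ z                 ∎

      conj-label-∈ : ConnectedOn G T → ∀ v₀ e → InGen γ′ (conj (δ v₀) (γ e))
      conj-label-∈ connected v₀ e = resp (≈-sym regroup)
        (mul (mul (tree-walk-∈ (connected v₀ (tail G e))) (gen e)) (tree-walk-∈ (connected (head G e) v₀)))
        where
          a = δ v₀
          regroup : conj a (γ e) ≈ ((a ⁻¹ ∙ δ (tail G e)) ∙ γ′ e) ∙ (δ (head G e) ⁻¹ ∙ a)
          regroup = ≈-trans (conj-cong a (γ≈switch e))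
            (solve 5 (λ A d x D a → ((A ⊛ ((d ⊛ x) ⊛ D)) ⊛ a) ⊜ (((A ⊛ d) ⊛ x) ⊛ (D ⊛ a))) ≈-refl
               (a ⁻¹) (δ (tail G e)) (γ′ e) (δ (head G e) ⁻¹) a)

      conjugating-element : ConnectedOn G T → Σ Carrier λ a → ∀ e → InGen γ′ (conj a (γ e))
      conjugating-element connected with Fin-inhabited? nV
      ... | yes v₀       = δ v₀ , conj-label-∈ connected v₀
      ... | no no-vertex = ε , λ e → ⊥-elim (no-vertex (tail G e))

    InGen-conj : ∀ {γ₁ γ₂ a} → (∀ e → InGen γ₂ (conj a (γ₁ e))) → ∀ {x} → InGen γ₁ x → InGen γ₂ (conj a x)
    InGen-conj         gen-∈ (gen e)      = gen-∈ e
    InGen-conj {a = a} gen-∈ one          = resp (≈-sym (conj-ε a)) one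
    InGen-conj {a = a} gen-∈ (mul p q)    = resp (≈-sym (conj-∙ a _ _)) (mul (InGen-conj gen-∈ p) (InGen-conj gen-∈ q))
    InGen-conj {a = a} gen-∈ (inv p)      = resp (≈-sym (conj-⁻¹ a _)) (inv (InGen-conj gen-∈ p))
    InGen-conj {a = a} gen-∈ (resp x≈y p) = resp (conj-cong a x≈y) (InGen-conj gen-∈ p)

    GenIsoZ2-unconj : ∀ {γ a r} → GenIsoZ2 (conj a ∘ γ) r → GenIsoZ2 γ r
    GenIsoZ2-unconj {γ} {a} iso = record
      { f         = conj (a ⁻¹) ∘ f
      ; hom       = λ u v → ≈-trans (conj-cong (a ⁻¹) (hom u v)) (conj-∙ (a ⁻¹) (f u) (f v))
      ; injective = λ u v eq → injective u v (conj-injective (a ⁻¹) eq)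
      ; into      = λ u → InGen-conj (λ e → resp (≈-sym (conj-conj (a ⁻¹) a (γ e) (inverseʳ a))) (gen e)) (into u)
      ; onto      = λ x x∈ → let u , fu≈ = onto (conj a x) (InGen-conj gen x∈)
                             in u , ≈-trans (conj-cong (a ⁻¹) fu≈) (conj-conj (a ⁻¹) a x (inverseʳ a))
      }
      where open GenIsoZ2 iso

    GenIsoZ2-subgroup : ∀ {γ γ′ k} → GenIsoZ2 γ′ k → (∀ e → InGen γ′ (γ e)) → Σ ℕ λ r → r ≤ k × GenIsoZ2 γ r
    GenIsoZ2-subgroup {γ} {γ′} {k} iso labels-∈ = dim , dim≤k , record
      { f = F ; hom = F-⊕ ; injective = λ u v eq → embed-injective u v (injective _ _ eq)
      ; into = λ u → span-∈ (embed-∈span u) ; onto = λ _ → onto-F }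
      where
        open GenIsoZ2 iso

        coords : Fin nE → Vec Bool k
        coords e = proj₁ (onto (γ e) (labels-∈ e))

        f-coords : ∀ e → f (coords e) ≈ γ e
        f-coords e = proj₂ (onto (γ e) (labels-∈ e))

        open Basis (basis k coords)

        F : Vec Bool dim → Carrier
        F = f ∘ embed

        F-⊕ : ∀ u v → F (u ⊕ v) ≈ F u ∙ F v
        F-⊕ u v = ≈-trans (reflexive (cong f (embed-⊕ u v))) (hom (embed u) (embed v))

        span-∈ : ∀ {w} → Span coords w → InGen γ (f w)
        span-∈ span-𝟘       = resp (≈-sym (homZ₂-𝟘 hom)) one
        span-∈ (span-gen e) = resp (≈-sym (f-coords e)) (gen e)
        span-∈ (span-⊕ s t) = resp (≈-sym (hom _ _)) (mul (span-∈ s) (span-∈ t))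

        onto-F : ∀ {x} → InGen γ x → Σ (Vec Bool dim) λ u → F u ≈ x
        onto-F (gen e) = let u , eq = gen-∈image e in u , ≈-trans (reflexive (cong f eq)) (f-coords e)
        onto-F one     = 𝟘 , homZ₂-𝟘 F-⊕
        onto-F (mul p q) with onto-F p | onto-F q
        ... | u , Fu≈x | v , Fv≈y = u ⊕ v , ≈-trans (F-⊕ u v) (∙-cong Fu≈x Fv≈y)
        onto-F (inv p) with onto-F p
        ... | u , Fu≈x = u , ≈-trans (≈-sym (homZ₂-⁻¹ F-⊕ u)) (⁻¹-cong Fu≈x)
        onto-F (resp x≈y p) with onto-F p
        ... | u , Fu≈x = u , ≈-trans Fu≈x x≈y

lemma5p3 : ∀ {c ℓ : Level} (𝔾 : Group c ℓ) (G : Graph) (γ : Labels.Labeling 𝔾 G)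
  (T : Subset (Graph.nE G)) → Connected G → SpanningTree G T →
  ∀ (γ' : Labels.Labeling 𝔾 G) (k : ℕ) → Labels.IsShifting 𝔾 G γ γ' → Labels.GenIsoZ2 𝔾 G γ' k →
  ∀ (γ'' : Labels.Labeling 𝔾 G) → Labels.IsShifting 𝔾 G γ γ'' → Labels.Normalized 𝔾 G T γ'' →
  Σ ℕ λ r → r ≤ k × Labels.GenIsoZ2 𝔾 G γ'' r
lemma5p3 𝔾 G γ T _ (T-connected , _) γ' k γ⇝γ' iso γ'' γ⇝γ'' normalized =
  let δ , γ''≈switch = shiftings-differ-by-switch 𝔾 G γ⇝γ' γ⇝γ''
      _ , conj-labels-∈ = conjugating-element 𝔾 G δ γ''≈switch normalized T-connected
      r , r≤k , iso-conj = GenIsoZ2-subgroup 𝔾 G iso conj-labels-∈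
  in r , r≤k , GenIsoZ2-unconj 𝔾 G iso-conj
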